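{- Let $f(x)$ be a separable polynomial of degree $d$ over a discretely valued field $K$ with a fixed labelling $x_1,\dots,x_d$ of its roots, and let $0\le n\le k_f-1$. Let $G\in\mathcal{G}_{n+1}(f)$ with $G\neq G_{n+1}(f)$ as unlabelled weighted graphs, and suppose $G$ and $G_{n+1}(f)$ have the same number of edges. Then $\textup{ord}(J_{G,f})>\textup{ord}(J_{G_{n+1}(f),f})$.
   Context: $\textup{ord}$ is the normalised valuation of $K$, extended to $\bar K$, $\textup{ord}(0)=\infty$. $d_n(f)$ is the $n$-th largest value of $\{\textup{ord}(x_i-x_j):i<j\}$ and $k_f$ the number of distinct values. Weighted graphs $G=(V,E,w)$ on $V=\{v_1,\dots,v_d\}$ with $w:E\to\mathbb{Z}_{\ge0}$ (non-edges weight $0$). $S_d$ acts by permuting vertices: $\sigma(E)=\{v_{\sigma(i)}v_{\sigma(j)}:v_iv_j\in E\}$, $\sigma(w)(v_{\sigma(i)}v_{\sigma(j)})=w(v_iv_j)$. $J_G=\sum_{\sigma\in S_d/\mathrm{Stab}_{S_d}(G)}1/\prod_{v_iv_j\in\sigma(E)}(X_i-X_j)^{2\sigma(w)(v_iv_j)}$, $J_{G,f}=J_G(x_1,\dots,x_d)$. $\mathbf{G}_d$: weighted graphs on $d$ vertices with $w$ surjective onto $\{1,\dots,m\}$ for some $m\ge1$ and $w(v_1v_2)\ge\min(w(v_2v_3),w(v_1v_3))$ for all vertices. $G_n(f)=(V,E_n,w_n)$ for $1\le n\le k_f$: $v_i\leftrightarrow x_i$, $E_n=\{v_iv_j:\textup{ord}(x_i-x_j)\ge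 d_n(f)\}$, $w_n(v_iv_j)=n+1-m$ if $\textup{ord}(x_i-x_j)=d_m(f)$; $G_0(f)$ empty. $G_n'(f)=(V,E_n,w_n')$ with $w_n'(v_iv_j)=n+2-m$ if $\textup{ord}(x_i-x_j)=d_m(f)$. $\mathcal{G}_{n+1}(f)$: the set of $H=(V,E,w)\in\mathbf{G}_d$ with $E\supsetneq E_n$, $w=w_n'$ on $E_n$, $w=1$ on $E\setminus E_n$, and $v_iv_j,v_jv_k\in E\Rightarrow v_iv_k\in E$ for distinct $i,j,k$. -}

module Defs where

open import Level using (Level; _⊔_) renaming (suc to lsuc)
open import Algebra.Bundles using (CommutativeRing)
open import Data.Bool using (if_then_else_)
open import Data.Nat as ℕ using (ℕ; zero; suc; _∸_; _≤_; _≤?_)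
open import Data.Integer as ℤ using (ℤ)
open import Data.Rational as ℚ using (ℚ; 1ℚ)
import Data.Rational.Properties as ℚP
open import Data.Fin as Fin using (Fin)
import Data.Fin.Properties as FinP
open import Data.List as List using (List; []; _∷_; _++_; map; filter; length; concatMap; deduplicate; allFin; foldr)
open import Data.List.Relation.Unary.All using (All)
open import Data.List.Relation.Unary.Any using (Any)
open import Data.Vec as Vec using (Vec)
open import Data.Product using (Σ; ∃; ∃-syntax; _×_; _,_; uncurry)
open import Relation.Nullary using (¬_; Dec; yes; no; does)
open import Relation.Nullary.Decidable using (¬?; _→-dec_)
open import Relation.Binary.PropositionalEquality using (_≡_; refl; cong)

data ℚ∞ : Set where
  fin : ℚ → ℚ∞
  ∞   : ℚ∞

infix 4 _≤∞_ _<∞_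

data _≤∞_ : ℚ∞ → ℚ∞ → Set where
  fin≤fin : ∀ {p q} → p ℚ.≤ q → fin p ≤∞ fin q
  _≤∞∞    : ∀ a → a ≤∞ ∞

data _<∞_ : ℚ∞ → ℚ∞ → Set where
  fin<fin : ∀ {p q} → p ℚ.< q → fin p <∞ fin q
  fin<∞   : ∀ {p} → fin p <∞ ∞

_<∞?_ : (a b : ℚ∞) → Dec (a <∞ b)
fin p <∞? fin q with p ℚP.<? q
... | yes h = yes (fin<fin h)
... | no h  = no λ { (fin<fin h') → h h' }
fin p <∞? ∞ = yes fin<∞
∞ <∞? fin q = no λ ()
∞ <∞? ∞ = no λ ()

_≟∞_ : (a b : ℚ∞) → Dec (a ≡ b)
fin p ≟∞ fin q with p ℚP.≟ q
... | yes refl = yes refl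
... | no h = no λ { refl → h refl }
fin p ≟∞ ∞ = no λ ()
∞ ≟∞ fin q = no λ ()
∞ ≟∞ ∞ = yes refl

infixl 6 _⊕_
_⊕_ : ℚ∞ → ℚ∞ → ℚ∞
fin p ⊕ fin q = fin (p ℚ.+ q)
fin p ⊕ ∞ = ∞
∞ ⊕ b = ∞

min∞ : ℚ∞ → ℚ∞ → ℚ∞
min∞ (fin p) (fin q) = fin (p ℚ.⊓ q)
min∞ (fin p) ∞ = fin p
min∞ ∞ b = b

-- Fields (commutative rings with a total inverse that inverts nonzero elements)

record Field c ℓ : Set (lsuc (c ⊔ ℓ)) where
  field
    commutativeRing : CommutativeRing c ℓ
  open CommutativeRing commutativeRing public
  infix 8 _⁻¹
  field
    _⁻¹      : Carrier → Carrier
    ⁻¹-cong  : ∀ {x y} → x ≈ y → x ⁻¹ ≈ y ⁻¹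
    0≉1      : ¬ (0# ≈ 1#)
    inverseʳ : ∀ x → ¬ (x ≈ 0#) → x * x ⁻¹ ≈ 1#

module FieldStuff {c ℓ} (L : Field c ℓ) where
  open Field L

  pow : Carrier → ℕ → Carrier
  pow a zero = 1#
  pow a (suc k) = a * pow a k

  -- polynomials as coefficient lists, lowest degree first
  eval : List Carrier → Carrier → Carrier
  eval [] t = 0#
  eval (a ∷ p) t = a + t * eval p t

  -- every polynomial of degree ≥ 1 has a root in L
  IsAlgClosed : Set (c ⊔ ℓ)
  IsAlgClosed = ∀ (c₀ : Carrier) (cs : List Carrier) (a : Carrier) → ¬ (a ≈ 0#) →
                ∃[ y ] eval (c₀ ∷ cs ++ a ∷ []) y ≈ 0#

  record IsSubfield (inK : Carrier → Set c) : Set (c ⊔ ℓ) where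
    field
      inK-cong : ∀ {a b} → a ≈ b → inK a → inK b
      inK-0    : inK 0#
      inK-1    : inK 1#
      inK-+    : ∀ {a b} → inK a → inK b → inK (a + b)
      inK-neg  : ∀ {a} → inK a → inK (- a)
      inK-*    : ∀ {a b} → inK a → inK b → inK (a * b)
      inK-⁻¹   : ∀ {a} → inK a → ¬ (a ≈ 0#) → inK (a ⁻¹)

  IsAlgebraicOver : (Carrier → Set c) → Set (c ⊔ ℓ)
  IsAlgebraicOver inK = ∀ y → ∃[ p ] (All inK p × Any (λ a → ¬ (a ≈ 0#)) p × eval p y ≈ 0#)

  record Valuation : Set (c ⊔ ℓ) where
    field
      ord      : Carrier → ℚ∞
      ord-cong : ∀ {a b} → a ≈ b → ord a ≡ ord b
      ord-0    : ord 0# ≡ ∞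
      ord-∞    : ∀ a → ord a ≡ ∞ → a ≈ 0#
      ord-*    : ∀ a b → ord (a * b) ≡ ord a ⊕ ord b
      ord-+    : ∀ a b → min∞ (ord a) (ord b) ≤∞ ord (a + b)

  -- the restriction of the valuation to K is discrete and normalised
  -- (value group of K^× is exactly ℤ)
  record IsDiscreteNormalisedOn (V : Valuation) (inK : Carrier → Set c) : Set (c ⊔ ℓ) where
    open Valuation V
    field
      integral    : ∀ a → inK a → ¬ (a ≈ 0#) → ∃[ z ] ord a ≡ fin (z ℚ./ 1)
      uniformiser : ∃[ π ] (inK π × ord π ≡ fin 1ℚ)

-- Weighted graphs on vertices v₁,…,v_d  (vertex i ↔ Fin d).
-- A weighted graph is given by its weight function; non-edges have
-- weight 0 and the edges are the pairs of positive weight.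

Graph : ℕ → Set
Graph d = Fin d → Fin d → ℕ

module Graphs {d : ℕ} where

  Edge : Graph d → Fin d → Fin d → Set
  Edge G i j = ¬ (G i j ≡ 0)

  -- unordered pairs {i,j}, listed as (i , j) with i < j
  pairs : List (Fin d × Fin d)
  pairs = concatMap (λ i → map (i ,_) (filter (λ j → i Fin.<? j) (allFin d))) (allFin d)

  numEdges : Graph d → ℕ
  numEdges G = length (filter (λ p → ¬? (uncurry G p ℕ.≟ 0)) pairs)

  IsWeightedGraph : Graph d → Set
  IsWeightedGraph G = (∀ i j → G i j ≡ G j i) × (∀ i → G i i ≡ 0)

  InGd : Graph d → Set
  InGd G = IsWeightedGraph G
         × (∃[ m ] (1 ≤ m
                   × (∀ i j → G i j ≤ m)
                   × (∀ k → 1 ≤ k → k ≤ m → ∃[ i ] ∃[ j ] G i j ≡ k)))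
         × (∀ i j k → ¬ i ≡ j → ¬ j ≡ k → ¬ i ≡ k →
              (G j k ℕ.⊓ G i k) ≤ G i j)

  _≅_ : Graph d → Graph d → Set
  G ≅ H = ∃[ σ ] ∀ i j → H (σ ⟨$⟩ʳ i) (σ ⟨$⟩ʳ j) ≡ G i j
    where open import Data.Fin.Permutation using (_⟨$⟩ʳ_)

  _≟G_ : (G H : Graph d) → Dec (∀ a b → G a b ≡ H a b)
  G ≟G H = FinP.all? λ a → FinP.all? λ b → G a b ℕ.≟ H a b

  vecs : (k : ℕ) → List (Vec (Fin d) k)
  vecs zero = Vec.[] ∷ []
  vecs (suc k) = concatMap (λ i → map (i Vec.∷_) (vecs k)) (allFin d)

  -- all permutations of Fin d (as injective tables)
  perms : List (Vec (Fin d) d)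
  perms = filter (λ v → FinP.all? λ a → FinP.all? λ b →
                     (Vec.lookup v a FinP.≟ Vec.lookup v b) →-dec (a FinP.≟ b))
                 (vecs d)

  -- the S_d-orbit {σ(G) : σ ∈ S_d} of G, without repetitions
  -- (σ(G)(a,b) = G(σ⁻¹a, σ⁻¹b); as σ ranges over S_d so does σ⁻¹)
  orbit : Graph d → List (Graph d)
  orbit G = deduplicate _≟G_ (map (λ v a b → G (Vec.lookup v a) (Vec.lookup v b)) perms)

module Setup {c ℓ} (L : Field c ℓ) (V : FieldStuff.Valuation L) {d : ℕ}
             (x : Fin d → Field.Carrier L) where
  open Field L
  open FieldStuff L
  open Valuation V
  open Graphs {d}

  δ : Fin d → Fin d → ℚ∞
  δ i j = ord (x i - x j)

  vals : List ℚ∞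
  vals = deduplicate _≟∞_ (map (uncurry δ) pairs)

  k_f : ℕ
  k_f = length vals

  -- for a value v = d_m(f), rankOf v = m  (1 + number of distinct values > v)
  rankOf : ℚ∞ → ℕ
  rankOf v = suc (length (filter (v <∞?_) vals))

  rank : Fin d → Fin d → ℕ
  rank i j = rankOf (δ i j)

  -- weight function with edges E_n = {ord ≥ d_n} = {rank ≤ n}, weight (t - m)
  private
    wt : ℕ → ℕ → Graph d
    wt n t i j = if does (i FinP.≟ j) then 0
                 else (if does (rank i j ≤? n) then t ∸ rank i j else 0)

  Gn : ℕ → Graph d
  Gn n = wt n (suc n)

  G′n : ℕ → Graph d
  G′n n = wt n (suc (suc n))

  𝒢-suc : ℕ → Graph d → Set
  𝒢-suc n H = InGd H
            × (∀ i j → Edge (Gn n) i j → Edge H i j)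
            × (∃[ i ] ∃[ j ] (Edge H i j × ¬ Edge (Gn n) i j))
            × (∀ i j → Edge (Gn n) i j → H i j ≡ G′n n i j)
            × (∀ i j → Edge H i j → ¬ Edge (Gn n) i j → H i j ≡ 1)
            × (∀ i j k → ¬ i ≡ j → ¬ j ≡ k → ¬ i ≡ k →
                 Edge H i j → Edge H j k → Edge H i k)

  term : Graph d → Carrier
  term H = (foldr _*_ 1# (map (λ p → pow (x (Data.Product.proj₁ p) - x (Data.Product.proj₂ p))
                                         (2 ℕ.* uncurry H p)) pairs)) ⁻¹

  J : Graph d → Carrier
  J G = foldr _+_ 0# (map term (orbit G))

module Submission where

-- Off the diagonal ord(x_i - x_j) is finite, so each summand of J_H has valuation
-- -2 Σ_{i<j} w(v_i v_j) ord(x_i - x_j) and it suffices to compare these weighted sums.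
-- Every relabelling of G or of G_{n+1}(f) has, at each level t, the same number of pairs
-- of weight > t: above level 0, G and G_{n+1}(f) differ only on pairs of weight ≤ 1, and
-- at level 0 this is the common number of edges.  In G_{n+1}(f) the pairs of weight > t
-- are exactly those with the largest values of ord(x_i - x_j), so an exchange argument
-- level by level shows that G_{n+1}(f) strictly maximises the weighted sum among all
-- these graphs other than itself.  Hence the summand of G_{n+1}(f) is the unique one of
-- minimal valuation in J_{G_{n+1}(f)}, and every summand of J_G has larger valuation.

open import Defs
open import Data.Nat using (ℕ; suc; _<_)
open import Data.Fin using (Fin)
open import Data.Rational using (ℚ)
open import Data.Vec using (Vec; toList; last)
open import Data.List.Relation.Unary.All using (All)
open import Relation.Nullary using (¬_)
open import Relation.Binary.PropositionalEquality using (_≡_)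

module ExtendedRationalProperties where

  open import Data.Rational as ℚ using (0ℚ)
  import Data.Rational.Properties as ℚP
  open import Data.Sum using (inj₁; inj₂)
  open import Data.Empty using (⊥-elim)
  open import Relation.Binary.Definitions using (tri<; tri≈; tri>)
  open import Relation.Binary.PropositionalEquality using (refl; cong; sym; subst)

  fin-injective : ∀ {p q} → fin p ≡ fin q → p ≡ q
  fin-injective refl = refl

  <∞-irrefl : ∀ {a} → ¬ (a <∞ a)
  <∞-irrefl (fin<fin p<p) = ℚP.<-irrefl refl p<p

  <∞-≤∞-trans : ∀ {a b c} → a <∞ b → b ≤∞ c → a <∞ c
  <∞-≤∞-trans (fin<fin p<q) (fin≤fin q≤r) = fin<fin (ℚP.<-≤-trans p<q q≤r)
  <∞-≤∞-trans (fin<fin _)   (_ ≤∞∞)       = fin<∞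
  <∞-≤∞-trans fin<∞         (_ ≤∞∞)       = fin<∞

  ≮∞-<∞-trans : ∀ {a b c} → ¬ (b <∞ a) → b <∞ c → a <∞ c
  ≮∞-<∞-trans {fin p} {fin q} b≮a (fin<fin q<r) =
    fin<fin (ℚP.≤-<-trans (ℚP.≮⇒≥ (λ q<p → b≮a (fin<fin q<p))) q<r)
  ≮∞-<∞-trans {fin p} {fin q} b≮a fin<∞         = fin<∞
  ≮∞-<∞-trans {∞}     {fin q} b≮a _             = ⊥-elim (b≮a fin<∞)

  <∞-min∞ : ∀ {a b c} → c <∞ a → c <∞ b → c <∞ min∞ a b
  <∞-min∞ {fin p} {fin q} (fin<fin r<p) (fin<fin r<q) with ℚP.≤-total p q
  ... | inj₁ p≤q = fin<fin (subst (_ ℚ.<_) (sym (ℚP.p≤q⇒p⊓q≡p p≤q)) r<p)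
  ... | inj₂ q≤p = fin<fin (subst (_ ℚ.<_) (sym (ℚP.p≥q⇒p⊓q≡q q≤p)) r<q)
  <∞-min∞ {fin p} {∞} c<a _ = c<a
  <∞-min∞ {∞}         _ c<b = c<b

  min∞-≡ʳ : ∀ {a b} → b <∞ a → min∞ a b ≡ b
  min∞-≡ʳ {fin p} (fin<fin q<p) = cong fin (ℚP.p≥q⇒p⊓q≡q (ℚP.<⇒≤ q<p))
  min∞-≡ʳ {∞}     _             = refl

  ≤∞∧≮∞⇒≡ : ∀ {a b} → a ≤∞ b → ¬ (a <∞ b) → a ≡ b
  ≤∞∧≮∞⇒≡ (fin≤fin {p} {q} p≤q) p≮q with ℚP.<-cmp p q
  ... | tri< p<q _ _ = ⊥-elim (p≮q (fin<fin p<q))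
  ... | tri≈ _ p≡q _ = cong fin p≡q
  ... | tri> _ _ p>q = ⊥-elim (ℚP.<-irrefl refl (ℚP.≤-<-trans p≤q p>q))
  ≤∞∧≮∞⇒≡ (fin p ≤∞∞) a≮∞ = ⊥-elim (a≮∞ fin<∞)
  ≤∞∧≮∞⇒≡ (∞ ≤∞∞)     _   = refl

  p+p≡0⇒p≡0 : ∀ {p} → p ℚ.+ p ≡ 0ℚ → p ≡ 0ℚ
  p+p≡0⇒p≡0 {p} p+p≡0 with ℚP.<-cmp p 0ℚ
  ... | tri< p<0 _ _ = ⊥-elim (ℚP.<-irrefl p+p≡0
                         (subst (p ℚ.+ p ℚ.<_) (ℚP.+-identityʳ 0ℚ) (ℚP.+-mono-< p<0 p<0)))
  ... | tri≈ _ p≡0 _ = p≡0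
  ... | tri> _ _ p>0 = ⊥-elim (ℚP.<-irrefl (sym p+p≡0)
                         (subst (ℚ._< p ℚ.+ p) (ℚP.+-identityʳ 0ℚ) (ℚP.+-mono-< p>0 p>0)))

open ExtendedRationalProperties

module RationalSums where

  open import Data.Rational as ℚ using (ℚ; 0ℚ)
  import Data.Rational.Properties as ℚP
  open import Data.List using (List; foldr)

  sumℚ : List ℚ → ℚ
  sumℚ = foldr ℚ._+_ 0ℚ

  open import Algebra.Definitions.RawMonoid ℚ.+-0-rawMonoid public using () renaming (_×_ to _×ℚ_)

open RationalSums

module ValuationProperties {c ℓ} (L : Field c ℓ) (V : FieldStuff.Valuation L) where

  open import Data.Nat using (zero)
  open import Data.Rational as ℚ using (ℚ; 0ℚ)
  import Data.Rational.Properties as ℚP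
  open import Data.List using (List; []; _∷_; map; foldr)
  open import Data.List.Relation.Unary.All as All using ([]; _∷_)
  import Data.List.Relation.Unary.All.Properties as All
  open import Data.List.Relation.Unary.AllPairs using (AllPairs; []; _∷_)
  open import Data.List.Relation.Unary.Any using (here; there)
  open import Data.List.Membership.Propositional using (_∈_)
  open import Data.Product using (_,_)
  open import Data.Empty using (⊥-elim)
  open import Relation.Binary.PropositionalEquality using (refl; cong; cong₂; sym; trans; subst; module ≡-Reasoning)
  import Algebra.Properties.Group as GroupProperties
  import Algebra.Properties.AbelianGroup as AbelianGroupProperties
  import Algebra.Properties.Ring as RingProperties

  open Field L hiding (refl; sym; trans)
  open Field L using () renaming (sym to ≈-sym; trans to ≈-trans)
  open FieldStuff L
  open Valuation V

  private
    module +G = GroupProperties +-group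
    module +A = AbelianGroupProperties +-abelianGroup
    module R = RingProperties ring

  ord-finite⇒≉0 : ∀ {a q} → ord a ≡ fin q → ¬ (a ≈ 0#)
  ord-finite⇒≉0 ord-a≡q a≈0 with trans (sym ord-a≡q) (trans (ord-cong a≈0) ord-0)
  ... | ()

  ord-1 : ord 1# ≡ fin 0ℚ
  ord-1 with ord 1# in ord-1≡
  ... | ∞     = ⊥-elim (0≉1 (≈-sym (ord-∞ 1# ord-1≡)))
  ... | fin q = cong fin (GroupProperties.identityˡ-unique ℚP.+-0-group q q (fin-injective q+q≡q))
    where
    q+q≡q : fin (q ℚ.+ q) ≡ fin q
    q+q≡q = trans (cong₂ _⊕_ (sym ord-1≡) (sym ord-1≡))
                  (trans (sym (ord-* 1# 1#)) (trans (ord-cong (*-identityˡ 1#)) ord-1≡))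

  ord-selfInverse : ∀ a → a * a ≈ 1# → ord a ≡ fin 0ℚ
  ord-selfInverse a a²≈1 with ord a in ord-a≡
  ... | ∞     = ⊥-elim (0≉1 (≈-trans (≈-sym (ord-∞ (a * a) ord-a²≡∞)) a²≈1))
    where
    ord-a²≡∞ : ord (a * a) ≡ ∞
    ord-a²≡∞ = trans (ord-* a a) (cong (_⊕ ord a) ord-a≡)
  ... | fin q = cong fin (p+p≡0⇒p≡0 (fin-injective q+q≡0))
    where
    q+q≡0 : fin (q ℚ.+ q) ≡ fin 0ℚ
    q+q≡0 = trans (cong₂ _⊕_ (sym ord-a≡) (sym ord-a≡))
                  (trans (sym (ord-* a a)) (trans (ord-cong a²≈1) ord-1))

  ord-neg : ∀ a → ord (- a) ≡ ord a
  ord-neg a = begin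
    ord (- a)              ≡⟨ ord-cong (R.-1*x≈-x a) ⟨
    ord (- 1# * a)         ≡⟨ ord-* (- 1#) a ⟩
    ord (- 1#) ⊕ ord a     ≡⟨ cong (_⊕ ord a) ord-neg1 ⟩
    fin 0ℚ ⊕ ord a         ≡⟨ ⊕-identityˡ (ord a) ⟩
    ord a                  ∎
    where
    open ≡-Reasoning
    ord-neg1 : ord (- 1#) ≡ fin 0ℚ
    ord-neg1 = ord-selfInverse (- 1#) (≈-trans (R.-1*x≈-x (- 1#)) (+G.⁻¹-involutive 1#))
    ⊕-identityˡ : ∀ b → fin 0ℚ ⊕ b ≡ b
    ⊕-identityˡ (fin p) = cong fin (ℚP.+-identityˡ p)
    ⊕-identityˡ ∞       = refl

  ord-⁻¹ : ∀ {a q} → ord a ≡ fin q → ord (a ⁻¹) ≡ fin (ℚ.- q)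
  ord-⁻¹ {a} {q} ord-a≡q with ord (a ⁻¹) in ord-a⁻¹≡
  ... | ∞     = ⊥-elim (0≉1 (≈-trans (≈-sym (ord-∞ (a * a ⁻¹) ord-aa⁻¹≡∞)) a*a⁻¹≈1))
    where
    a*a⁻¹≈1 = inverseʳ a (ord-finite⇒≉0 ord-a≡q)
    ord-aa⁻¹≡∞ : ord (a * a ⁻¹) ≡ ∞
    ord-aa⁻¹≡∞ = trans (ord-* a (a ⁻¹)) (cong₂ _⊕_ ord-a≡q ord-a⁻¹≡)
  ... | fin r = cong fin (GroupProperties.inverseʳ-unique ℚP.+-0-group q r (fin-injective q+r≡0))
    where
    q+r≡0 : fin (q ℚ.+ r) ≡ fin 0ℚ
    q+r≡0 = trans (cong₂ _⊕_ (sym ord-a≡q) (sym ord-a⁻¹≡))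
              (trans (sym (ord-* a (a ⁻¹))) (trans (ord-cong (inverseʳ a (ord-finite⇒≉0 ord-a≡q))) ord-1))

  ord-pow : ∀ {a q} k → ord a ≡ fin q → ord (pow a k) ≡ fin (k ×ℚ q)
  ord-pow zero    _       = ord-1
  ord-pow {a} (suc k) ord-a≡q = trans (ord-* a (pow a k)) (cong₂ _⊕_ ord-a≡q (ord-pow k ord-a≡q))

  ord-product : ∀ {A : Set} (f : A → Carrier) (g : A → ℚ) (xs : List A) →
                All (λ x → ord (f x) ≡ fin (g x)) xs →
                ord (foldr _*_ 1# (map f xs)) ≡ fin (sumℚ (map g xs))
  ord-product f g []       []         = ord-1
  ord-product f g (x ∷ xs) (fx ∷ fxs) = trans (ord-* (f x) _) (cong₂ _⊕_ fx (ord-product f g xs fxs))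

  <∞-ord-+ : ∀ {e a b} → e <∞ ord a → e <∞ ord b → e <∞ ord (a + b)
  <∞-ord-+ e<a e<b = <∞-≤∞-trans (<∞-min∞ e<a e<b) (ord-+ _ _)

  <∞-ord-sum : ∀ {q} (zs : List Carrier) → All (λ z → fin q <∞ ord z) zs → fin q <∞ ord (foldr _+_ 0# zs)
  <∞-ord-sum []       []         = subst (_ <∞_) (sym ord-0) fin<∞
  <∞-ord-sum (z ∷ zs) (e<z ∷ e<zs) = <∞-ord-+ e<z (<∞-ord-sum zs e<zs)

  -- An element strictly above the other summand cannot be cancelled: write b = (a + b) + (- a).
  ord-+-≡ʳ : ∀ a b → ord b <∞ ord a → ord (a + b) ≡ ord b
  ord-+-≡ʳ a b b<a = sym (≤∞∧≮∞⇒≡ b≤a+b b≮a+b)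
    where
    b≤a+b : ord b ≤∞ ord (a + b)
    b≤a+b = subst (_≤∞ ord (a + b)) (min∞-≡ʳ b<a) (ord-+ a b)
    b≮a+b : ¬ (ord b <∞ ord (a + b))
    b≮a+b b<a+b = <∞-irrefl (<∞-≤∞-trans (<∞-min∞ b<a+b (subst (ord b <∞_) (sym (ord-neg a)) b<a))
      (subst (min∞ (ord (a + b)) (ord (- a)) ≤∞_) (ord-cong (+A.xyx⁻¹≈y a b)) (ord-+ (a + b) (- a))))

  ord-+-≡ˡ : ∀ a b → ord a <∞ ord b → ord (a + b) ≡ ord a
  ord-+-≡ˡ a b a<b = trans (ord-cong (+-comm a b)) (ord-+-≡ʳ b a a<b)

  ord-sum-uniqueMin : ∀ {A : Set} (R : A → A → Set) (R-sym : ∀ {x y} → R x y → R y x)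
    (t : A → Carrier) {y : A} {q : ℚ} → ord (t y) ≡ fin q →
    ∀ xs → AllPairs (λ x x′ → ¬ R x x′) xs → y ∈ xs →
    All (λ x → ¬ R x y → fin q <∞ ord (t x)) xs →
    ord (foldr _+_ 0# (map t xs)) ≡ fin q
  ord-sum-uniqueMin R R-sym t {y} {q} ord-ty (x ∷ xs) (x≁xs ∷ _) (here refl) (_ ∷ xs-above) =
    trans (ord-+-≡ˡ (t x) _ (subst (_<∞ ord (foldr _+_ 0# (map t xs))) (sym ord-ty) rest-above)) ord-ty
    where
    rest-above : fin q <∞ ord (foldr _+_ 0# (map t xs))
    rest-above = <∞-ord-sum _ (All.map⁺ (All.zipWith
      (λ (x≁z , above) → above (λ z~x → x≁z (R-sym z~x))) (x≁xs , xs-above)))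
  ord-sum-uniqueMin R R-sym t ord-ty (x ∷ xs) (x≁xs ∷ xs-unique) (there y∈xs) (x-above ∷ xs-above) =
    trans (ord-+-≡ʳ (t x) _ (subst (_<∞ ord (t x)) (sym rest≡q) (x-above (All.lookup x≁xs y∈xs)))) rest≡q
    where
    rest≡q = ord-sum-uniqueMin R R-sym t ord-ty xs xs-unique y∈xs xs-above

module Rearrangement {P : Set} (δ : P → ℚ) where

  open import Data.Nat as ℕ using (zero; _⊓_; _<?_)
  import Data.Nat.Properties as ℕP
  open import Data.Rational as ℚ using (ℚ; 0ℚ)
  import Data.Rational.Properties as ℚP
  open import Data.Bool using (if_then_else_)
  open import Data.List using (List; []; _∷_; map; filter; length)
  import Data.List.Properties as List
  open import Data.List.Relation.Unary.All as All using ([]; _∷_)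
  import Data.List.Relation.Unary.All.Properties as All
  open import Data.List.Relation.Unary.Any using (Any)
  open import Data.List.Membership.Propositional using (_∈_; find; lose)
  import Data.List.Membership.Propositional.Properties as Mem
  open import Data.Product using (_×_; _,_; ∃-syntax)
  open import Data.Sum using (_⊎_; inj₁; inj₂)
  open import Data.Empty using (⊥-elim)
  open import Level using (0ℓ)
  open import Relation.Unary using (Pred; Decidable; _∩_; _∪_; _∖_)
  open import Relation.Unary.Properties using (_∩?_; ∁?)
  open import Relation.Nullary using (Dec; yes; no; does)
  open import Relation.Binary.Definitions using (tri<; tri≈; tri>)
  open import Relation.Binary.PropositionalEquality using (refl; cong; cong₂; sym; trans; subst; subst₂; module ≡-Reasoning)
  open import Algebra.Bundles using (CommutativeMonoid)
  open import Algebra.Properties.CommutativeSemigroup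
    (CommutativeMonoid.commutativeSemigroup ℚP.+-0-commutativeMonoid) using (interchange)
  open import Algebra.Properties.Monoid.Mult ℚP.+-0-monoid using (×-homo-+)

  Σδ : List P → ℚ
  Σδ xs = sumℚ (map δ xs)

  sumℚ-map-+ : ∀ (f g : P → ℚ) ps →
    sumℚ (map (λ p → f p ℚ.+ g p) ps) ≡ sumℚ (map f ps) ℚ.+ sumℚ (map g ps)
  sumℚ-map-+ f g []       = sym (ℚP.+-identityˡ 0ℚ)
  sumℚ-map-+ f g (p ∷ ps) = trans (cong (f p ℚ.+ g p ℚ.+_) (sumℚ-map-+ f g ps)) (interchange (f p) (g p) _ _)

  Σδ-filter : ∀ {A : Pred P 0ℓ} (A? : Decidable A) ps →
    Σδ (filter A? ps) ≡ sumℚ (map (λ p → if does (A? p) then δ p else 0ℚ) ps)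
  Σδ-filter A? []       = refl
  Σδ-filter A? (p ∷ ps) with A? p
  ... | yes _ = cong (δ p ℚ.+_) (Σδ-filter A? ps)
  ... | no  _ = trans (Σδ-filter A? ps) (sym (ℚP.+-identityˡ _))

  module _ {A B : Pred P 0ℓ} (A? : Decidable A) (B? : Decidable B) where

    Σδ-filter-split : ∀ ps →
      Σδ (filter A? ps) ≡ Σδ (filter (A? ∩? B?) ps) ℚ.+ Σδ (filter (A? ∩? ∁? B?) ps)
    Σδ-filter-split []       = sym (ℚP.+-identityˡ 0ℚ)
    Σδ-filter-split (p ∷ ps) with A? p | B? p
    ... | no _  | _     = Σδ-filter-split ps
    ... | yes _ | yes _ = trans (cong (δ p ℚ.+_) (Σδ-filter-split ps)) (sym (ℚP.+-assoc (δ p) _ _))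
    ... | yes _ | no  _ = begin
      δ p ℚ.+ Σδ (filter A? ps)       ≡⟨ cong (δ p ℚ.+_) (Σδ-filter-split ps) ⟩
      δ p ℚ.+ (Σ∩ ℚ.+ Σ∖)             ≡⟨ ℚP.+-assoc (δ p) Σ∩ Σ∖ ⟨
      δ p ℚ.+ Σ∩ ℚ.+ Σ∖               ≡⟨ cong (ℚ._+ Σ∖) (ℚP.+-comm (δ p) Σ∩) ⟩
      Σ∩ ℚ.+ δ p ℚ.+ Σ∖               ≡⟨ ℚP.+-assoc Σ∩ (δ p) Σ∖ ⟩
      Σ∩ ℚ.+ (δ p ℚ.+ Σ∖)             ∎
      where
      open ≡-Reasoning
      Σ∩ = Σδ (filter (A? ∩? B?) ps)
      Σ∖ = Σδ (filter (A? ∩? ∁? B?) ps)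

    length-filter-split : ∀ ps →
      length (filter A? ps) ≡ length (filter (A? ∩? B?) ps) ℕ.+ length (filter (A? ∩? ∁? B?) ps)
    length-filter-split []       = refl
    length-filter-split (p ∷ ps) with A? p | B? p
    ... | no _  | _     = length-filter-split ps
    ... | yes _ | yes _ = cong suc (length-filter-split ps)
    ... | yes _ | no  _ = trans (cong suc (length-filter-split ps)) (sym (ℕP.+-suc _ _))

  module _ {X Y : Pred P 0ℓ} (δX<δY : ∀ {x y} → X x → Y y → δ x ℚ.< δ y) where

    Σδ-mono-pointwise : ∀ xs ys → length xs ≡ length ys → All X xs → All Y ys → Σδ xs ℚ.≤ Σδ ys
    Σδ-mono-pointwise []       []       _   _        _        = ℚP.≤-refl
    Σδ-mono-pointwise (x ∷ xs) (y ∷ ys) |≡| (Xx ∷ X*) (Yy ∷ Y*) =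
      ℚP.+-mono-≤ (ℚP.<⇒≤ (δX<δY Xx Yy)) (Σδ-mono-pointwise xs ys (ℕP.suc-injective |≡|) X* Y*)

    Σδ-strictMono-pointwise : ∀ xs ys → length xs ≡ length ys → 0 < length xs →
      All X xs → All Y ys → Σδ xs ℚ.< Σδ ys
    Σδ-strictMono-pointwise (x ∷ xs) (y ∷ ys) |≡| _ (Xx ∷ X*) (Yy ∷ Y*) =
      ℚP.+-mono-<-≤ (δX<δY Xx Yy) (Σδ-mono-pointwise xs ys (ℕP.suc-injective |≡|) X* Y*)

  -- Exchange argument: A and T share A ∩ T, and every element of A ∖ T lies below
  -- every element of T ∖ A, a set of the same size.
  module Exchange {A T : Pred P 0ℓ} (A? : Decidable A) (T? : Decidable T) (ps : List P)
    (T-upper : ∀ {p q} → p ∈ ps → q ∈ ps → T p → ¬ T q → δ q ℚ.< δ p)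
    (|A|≡|T| : length (filter A? ps) ≡ length (filter T? ps)) where

    private
      A∖T = filter (A? ∩? ∁? T?) ps
      T∖A = filter (T? ∩? ∁? A?) ps

      A∩T≡T∩A : filter (A? ∩? T?) ps ≡ filter (T? ∩? A?) ps
      A∩T≡T∩A = List.filter-≐ (A? ∩? T?) (T? ∩? A?) ((λ (a , t) → t , a) , (λ (t , a) → a , t)) ps

      |A∖T|≡|T∖A| : length A∖T ≡ length T∖A
      |A∖T|≡|T∖A| = ℕP.+-cancelˡ-≡ (length (filter (A? ∩? T?) ps)) _ _ (begin
        length (filter (A? ∩? T?) ps) ℕ.+ length A∖T  ≡⟨ length-filter-split A? T? ps ⟨
        length (filter A? ps)                          ≡⟨ |A|≡|T| ⟩
        length (filter T? ps)                          ≡⟨ length-filter-split T? A? ps ⟩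
        length (filter (T? ∩? A?) ps) ℕ.+ length T∖A
          ≡⟨ cong (λ l → length l ℕ.+ length T∖A) A∩T≡T∩A ⟨
        length (filter (A? ∩? T?) ps) ℕ.+ length T∖A  ∎)
        where open ≡-Reasoning

      ΣA≡ : Σδ (filter A? ps) ≡ Σδ (filter (A? ∩? T?) ps) ℚ.+ Σδ A∖T
      ΣA≡ = Σδ-filter-split A? T? ps

      ΣT≡ : Σδ (filter T? ps) ≡ Σδ (filter (A? ∩? T?) ps) ℚ.+ Σδ T∖A
      ΣT≡ = trans (Σδ-filter-split T? A? ps) (cong (λ l → Σδ l ℚ.+ Σδ T∖A) (sym A∩T≡T∩A))

      members : ∀ {B : Pred P 0ℓ} (B? : Decidable B) → All (λ p → p ∈ ps × B p) (filter B? ps)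
      members B? = All.tabulate (Mem.∈-filter⁻ B?)

      A∖T<T∖A : ∀ {x y} → x ∈ ps × (A ∖ T) x → y ∈ ps × (T ∖ A) y → δ x ℚ.< δ y
      A∖T<T∖A (x∈ , _ , ¬Tx) (y∈ , Ty , _) = T-upper y∈ x∈ Ty ¬Tx

    Σδ-filter-<-upper : Any ((A ∖ T) ∪ (T ∖ A)) ps → Σδ (filter A? ps) ℚ.< Σδ (filter T? ps)
    Σδ-filter-<-upper differ = subst₂ ℚ._<_ (sym ΣA≡) (sym ΣT≡)
      (ℚP.+-monoʳ-< (Σδ (filter (A? ∩? T?) ps))
        (Σδ-strictMono-pointwise A∖T<T∖A A∖T T∖A |A∖T|≡|T∖A| A∖T≢∅
          (members (A? ∩? ∁? T?)) (members (T? ∩? ∁? A?))))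
      where
      A∖T≢∅ : 0 < length A∖T
      A∖T≢∅ with find differ
      ... | p , p∈ , inj₁ A∖Tp = List.filter-some (A? ∩? ∁? T?) (lose p∈ A∖Tp)
      ... | p , p∈ , inj₂ T∖Ap =
        subst (0 ℕ.<_) (sym |A∖T|≡|T∖A|) (List.filter-some (T? ∩? ∁? A?) (lose p∈ T∖Ap))

    Σδ-filter-≤-upper : Σδ (filter A? ps) ℚ.≤ Σδ (filter T? ps)
    Σδ-filter-≤-upper = subst₂ ℚ._≤_ (sym ΣA≡) (sym ΣT≡)
      (ℚP.+-monoʳ-≤ (Σδ (filter (A? ∩? T?) ps)) (Σδ-mono-pointwise A∖T<T∖A A∖T T∖A |A∖T|≡|T∖A|
                        (members (A? ∩? ∁? T?)) (members (T? ∩? ∁? A?))))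

  weight : (P → ℕ) → List P → ℚ
  weight h ps = sumℚ (map (λ p → h p ×ℚ δ p) ps)

  level : (P → ℕ) → ℕ → List P → ℚ
  level h t ps = Σδ (filter (λ p → t <? h p) ps)

  levels : (P → ℕ) → ℕ → List P → ℚ
  levels h zero    ps = 0ℚ
  levels h (suc k) ps = levels h k ps ℚ.+ level h k ps

  private
    ⊓-suc-×ℚ : ∀ m k q (k<?m : Dec (k ℕ.< m)) →
      (m ⊓ suc k) ×ℚ q ≡ (m ⊓ k) ×ℚ q ℚ.+ (if does k<?m then q else 0ℚ)
    ⊓-suc-×ℚ m k q (yes k<m) rewrite ℕP.m≥n⇒m⊓n≡n k<m | ℕP.m≥n⇒m⊓n≡n (ℕP.<⇒≤ k<m) =
      trans (×-homo-+ q 1 k) (trans (cong (ℚ._+ k ×ℚ q) (ℚP.+-identityʳ q)) (ℚP.+-comm q (k ×ℚ q)))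
    ⊓-suc-×ℚ m k q (no k≮m)
      rewrite ℕP.m≤n⇒m⊓n≡m (ℕP.m≤n⇒m≤1+n (ℕP.≮⇒≥ k≮m)) | ℕP.m≤n⇒m⊓n≡m (ℕP.≮⇒≥ k≮m) =
      sym (ℚP.+-identityʳ _)

  weight-⊓≡levels : ∀ h k ps → weight (λ p → h p ⊓ k) ps ≡ levels h k ps
  weight-⊓≡levels h zero    ps = weight-0 ps
    where
    weight-0 : ∀ ps → weight (λ p → h p ⊓ 0) ps ≡ 0ℚ
    weight-0 []       = refl
    weight-0 (p ∷ ps) rewrite ℕP.⊓-zeroʳ (h p) = trans (ℚP.+-identityˡ _) (weight-0 ps)
  weight-⊓≡levels h (suc k) ps = begin
    weight (λ p → h p ⊓ suc k) ps
      ≡⟨ cong sumℚ (List.map-cong (λ p → ⊓-suc-×ℚ (h p) k (δ p) (k <? h p)) ps) ⟩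
    sumℚ (map (λ p → (h p ⊓ k) ×ℚ δ p ℚ.+ (if does (k <? h p) then δ p else 0ℚ)) ps)
      ≡⟨ sumℚ-map-+ _ _ ps ⟩
    weight (λ p → h p ⊓ k) ps ℚ.+ sumℚ (map (λ p → if does (k <? h p) then δ p else 0ℚ) ps)
      ≡⟨ cong₂ ℚ._+_ (weight-⊓≡levels h k ps) (sym (Σδ-filter (λ p → k <? h p) ps)) ⟩
    levels h (suc k) ps ∎
    where open ≡-Reasoning

  weight≡levels : ∀ h M ps → All (λ p → h p ℕ.≤ M) ps → weight h ps ≡ levels h M ps
  weight≡levels h M ps h≤M = trans (cong sumℚ (List.map-cong-local
      (All.map (λ {p} h≤M → cong (_×ℚ δ p) (sym (ℕP.m≤n⇒m⊓n≡m h≤M))) h≤M)))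
    (weight-⊓≡levels h M ps)

  levels-mono : ∀ h g k ps → (∀ t → level h t ps ℚ.≤ level g t ps) → levels h k ps ℚ.≤ levels g k ps
  levels-mono h g zero    ps _   = ℚP.≤-refl
  levels-mono h g (suc k) ps h≤g = ℚP.+-mono-≤ (levels-mono h g k ps h≤g) (h≤g k)

  levels-strictMono : ∀ h g {t} k ps → t ℕ.< k → (∀ t → level h t ps ℚ.≤ level g t ps) →
    level h t ps ℚ.< level g t ps → levels h k ps ℚ.< levels g k ps
  levels-strictMono h g (suc k) ps t<1+k h≤g h<g with ℕP.m≤n⇒m<n∨m≡n (ℕP.≤-pred t<1+k)
  ... | inj₁ t<k  = ℚP.+-mono-<-≤ (levels-strictMono h g k ps t<k h≤g h<g) (h≤g k)
  ... | inj₂ refl = ℚP.+-mono-≤-< (levels-mono h g k ps h≤g) h<g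

  separatingLevel : ∀ {m n M} → ¬ m ≡ n → m ℕ.≤ M → n ℕ.≤ M →
    ∃[ t ] t ℕ.< M × ((t ℕ.< m × ¬ t ℕ.< n) ⊎ (t ℕ.< n × ¬ t ℕ.< m))
  separatingLevel {m} {n} m≢n m≤M n≤M with ℕP.<-cmp m n
  ... | tri< m<n _ _ = m , ℕP.<-≤-trans m<n n≤M , inj₂ (m<n , ℕP.<-irrefl refl)
  ... | tri≈ _ m≡n _ = ⊥-elim (m≢n m≡n)
  ... | tri> _ _ n<m = n , ℕP.<-≤-trans n<m m≤M , inj₁ (n<m , ℕP.<-irrefl refl)

  -- Layer-cake: weight h is the sum over t < M of the δ-mass of {t < h}, compared level by level.
  weight-<-rearrangement : ∀ (h g : P → ℕ) M ps →
    All (λ p → h p ℕ.≤ M) ps → All (λ p → g p ℕ.≤ M) ps →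
    (∀ t → length (filter (λ p → t <? h p) ps) ≡ length (filter (λ p → t <? g p) ps)) →
    (∀ t {p q} → p ∈ ps → q ∈ ps → t ℕ.< g p → ¬ (t ℕ.< g q) → δ q ℚ.< δ p) →
    Any (λ p → ¬ h p ≡ g p) ps → weight h ps ℚ.< weight g ps
  weight-<-rearrangement h g M ps h≤M g≤M same-counts g-upper h≢g
    with p , p∈ , hp≢gp ← find h≢g
    with t , t<M , p-separated ← separatingLevel hp≢gp (All.lookup h≤M p∈) (All.lookup g≤M p∈) =
    subst₂ ℚ._<_ (sym (weight≡levels h M ps h≤M)) (sym (weight≡levels g M ps g≤M))
      (levels-strictMono h g M ps t<M (λ t → E.Σδ-filter-≤-upper t) (E.Σδ-filter-<-upper t (lose p∈ p-separated)))
    where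
    module E t = Exchange (λ p → t <? h p) (λ p → t <? g p) ps (g-upper t) (same-counts t)

module UnorderedPairs {d : ℕ} where

  open import Data.Nat as ℕ using (zero; _+_; _*_; _<?_)
  import Data.Nat.Properties as ℕP
  open import Data.Nat.ListAction using (sum)
  open import Data.Nat.ListAction.Properties using (sum-++)
  open import Data.Fin as Fin using (zero; suc)
  import Data.Fin.Properties as FinP
  open import Data.Fin.Permutation using (Permutation; _⟨$⟩ʳ_)
  open import Data.Bool using (if_then_else_)
  open import Data.List using (List; []; _∷_; map; filter; length; concat; allFin; tabulate)
  import Data.List.Properties as List
  open import Data.List.Membership.Propositional using (_∈_)
  import Data.List.Membership.Propositional.Properties as Mem
  open import Data.Product using (_×_; _,_; proj₁; proj₂; uncurry)
  open import Data.Empty using (⊥-elim)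
  open import Function using (_∘_)
  open import Level using (0ℓ)
  open import Relation.Unary using (Pred; Decidable)
  open import Relation.Nullary using (Dec; yes; no; does)
  open import Relation.Binary.Definitions using (tri<; tri≈; tri>)
  open import Relation.Binary.PropositionalEquality using (refl; cong; cong₂; sym; trans; module ≡-Reasoning)
  open import Algebra.Properties.CommutativeMonoid.Sum ℕP.+-0-commutativeMonoid as ∑
    using (∑-comm; ∑-distrib-+; ∑-permute; sum-cong-≗)
  open Graphs {d} using (pairs; IsWeightedGraph)

  private
    row : Fin d → List (Fin d × Fin d)
    row i = map (i ,_) (filter (i Fin.<?_) (allFin d))

  ∈-pairs⁺ : ∀ {i j} → i Fin.< j → (i , j) ∈ pairs
  ∈-pairs⁺ {i} {j} i<j =
    Mem.∈-concat⁺′ (Mem.∈-map⁺ (i ,_) (Mem.∈-filter⁺ (i Fin.<?_) (Mem.∈-allFin j) i<j))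
                   (Mem.∈-map⁺ row (Mem.∈-allFin i))

  ∈-pairs⁻ : ∀ {p} → p ∈ pairs → proj₁ p Fin.< proj₂ p
  ∈-pairs⁻ p∈
    with _ , p∈row , row∈ ← Mem.∈-concat⁻′ (map row (allFin d)) p∈
    with i , _ , refl ← Mem.∈-map⁻ row row∈
    with _ , j∈ , refl ← Mem.∈-map⁻ (i ,_) p∈row = proj₂ (Mem.∈-filter⁻ (i Fin.<?_) {xs = allFin d} j∈)

  private
    sum-map-concat : ∀ {A : Set} (f : A → ℕ) xss → sum (map f (concat xss)) ≡ sum (map (sum ∘ map f) xss)
    sum-map-concat f []         = refl
    sum-map-concat f (xs ∷ xss) = trans (cong sum (List.map-++ f xs (concat xss)))
      (trans (sum-++ (map f xs) _) (cong (sum (map f xs) +_) (sum-map-concat f xss)))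

    sum-map-filter : ∀ {A : Set} {P : Pred A 0ℓ} (P? : Decidable P) (f : A → ℕ) xs →
      sum (map f (filter P? xs)) ≡ sum (map (λ x → if does (P? x) then f x else 0) xs)
    sum-map-filter P? f []       = refl
    sum-map-filter P? f (x ∷ xs) with P? x
    ... | yes _ = cong (f x +_) (sum-map-filter P? f xs)
    ... | no  _ = sum-map-filter P? f xs

    sum-map-allFin : ∀ {n} (f : Fin n → ℕ) → sum (map f (allFin n)) ≡ ∑.sum f
    sum-map-allFin {n} f = trans (cong sum (List.map-tabulate (λ i → i) f)) (sum-tabulate f)
      where
      sum-tabulate : ∀ {n} (f : Fin n → ℕ) → sum (tabulate f) ≡ ∑.sum f
      sum-tabulate {zero}  f = refl
      sum-tabulate {suc n} f = cong (f zero +_) (sum-tabulate (f ∘ suc))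

  sumPairs : (Fin d → Fin d → ℕ) → ℕ
  sumPairs g = sum (map (uncurry g) pairs)

  upper : (Fin d → Fin d → ℕ) → Fin d → Fin d → ℕ
  upper g i j = if does (i Fin.<? j) then g i j else 0

  sumPairs≡∑∑upper : ∀ g → sumPairs g ≡ ∑.sum (λ i → ∑.sum (upper g i))
  sumPairs≡∑∑upper g = begin
    sum (map (uncurry g) (concat (map row (allFin d))))     ≡⟨ sum-map-concat (uncurry g) (map row (allFin d)) ⟩
    sum (map (sum ∘ map (uncurry g)) (map row (allFin d)))  ≡⟨ cong sum (List.map-∘ (allFin d)) ⟨
    sum (map (sum ∘ map (uncurry g) ∘ row) (allFin d))      ≡⟨ cong sum (List.map-cong row-sum (allFin d)) ⟩
    sum (map (∑.sum ∘ upper g) (allFin d))                  ≡⟨ sum-map-allFin (∑.sum ∘ upper g) ⟩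
    ∑.sum (λ i → ∑.sum (upper g i))                         ∎
    where
    open ≡-Reasoning
    row-sum : ∀ i → sum (map (uncurry g) (row i)) ≡ ∑.sum (upper g i)
    row-sum i = trans (cong sum (sym (List.map-∘ (filter (i Fin.<?_) (allFin d)))))
      (trans (sum-map-filter (i Fin.<?_) (g i) (allFin d)) (sum-map-allFin (upper g i)))

  upper-+-transpose : ∀ g → IsWeightedGraph g → ∀ i j → g i j ≡ upper g i j + upper g j i
  upper-+-transpose g (g-sym , g-diag) i j = split (i Fin.<? j) (j Fin.<? i)
    where
    split : (i<?j : Dec (i Fin.< j)) (j<?i : Dec (j Fin.< i)) →
      g i j ≡ (if does i<?j then g i j else 0) + (if does j<?i then g j i else 0)
    split (yes i<j) (yes j<i) = ⊥-elim (FinP.<-asym i<j j<i)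
    split (yes _)   (no _)    = sym (ℕP.+-identityʳ _)
    split (no _)    (yes _)   = g-sym i j
    split (no i≮j)  (no j≮i) with FinP.<-cmp i j
    ... | tri< i<j _ _ = ⊥-elim (i≮j i<j)
    ... | tri> _ _ j<i = ⊥-elim (j≮i j<i)
    ... | tri≈ _ refl _ = g-diag i

  2*sumPairs≡∑∑ : ∀ g → IsWeightedGraph g → 2 * sumPairs g ≡ ∑.sum (λ i → ∑.sum (g i))
  2*sumPairs≡∑∑ g wg = sym (begin
    ∑.sum (λ i → ∑.sum (g i))
      ≡⟨ sum-cong-≗ (λ i → sum-cong-≗ (upper-+-transpose g wg i)) ⟩
    ∑.sum (λ i → ∑.sum (λ j → upper g i j + upper g j i))
      ≡⟨ sum-cong-≗ (λ i → ∑-distrib-+ (upper g i) (λ j → upper g j i)) ⟩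
    ∑.sum (λ i → ∑.sum (upper g i) + ∑.sum (λ j → upper g j i))
      ≡⟨ ∑-distrib-+ (λ i → ∑.sum (upper g i)) (λ i → ∑.sum (λ j → upper g j i)) ⟩
    U + ∑.sum (λ i → ∑.sum (λ j → upper g j i))
      ≡⟨ cong (U +_) (∑-comm (λ i j → upper g j i)) ⟩
    U + U
      ≡⟨ cong₂ _+_ (sym (sumPairs≡∑∑upper g))
                   (trans (sym (sumPairs≡∑∑upper g)) (sym (ℕP.+-identityʳ _))) ⟩
    2 * sumPairs g ∎)
    where
    open ≡-Reasoning
    U = ∑.sum (λ i → ∑.sum (upper g i))

  sumPairs-permute : ∀ g → IsWeightedGraph g → (π : Permutation d d) →
    sumPairs (λ a b → g (π ⟨$⟩ʳ a) (π ⟨$⟩ʳ b)) ≡ sumPairs g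
  sumPairs-permute g wg@(g-sym , g-diag) π = ℕP.*-cancelˡ-≡ _ _ 2 (begin
    2 * sumPairs gπ
      ≡⟨ 2*sumPairs≡∑∑ gπ ((λ _ _ → g-sym _ _) , (λ _ → g-diag _)) ⟩
    ∑.sum (λ i → ∑.sum (λ j → g (π ⟨$⟩ʳ i) (π ⟨$⟩ʳ j)))
      ≡⟨ sum-cong-≗ (λ i → sym (∑-permute (g (π ⟨$⟩ʳ i)) π)) ⟩
    ∑.sum (λ i → ∑.sum (g (π ⟨$⟩ʳ i)))          ≡⟨ ∑-permute (λ i → ∑.sum (g i)) π ⟨
    ∑.sum (λ i → ∑.sum (g i))                    ≡⟨ 2*sumPairs≡∑∑ g wg ⟨
    2 * sumPairs g                               ∎)
    where
    open ≡-Reasoning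
    gπ = λ a b → g (π ⟨$⟩ʳ a) (π ⟨$⟩ʳ b)

  length-filter≡sum : ∀ {A : Set} {P : Pred A 0ℓ} (P? : Decidable P) xs →
    length (filter P? xs) ≡ sum (map (λ x → if does (P? x) then 1 else 0) xs)
  length-filter≡sum P? []       = refl
  length-filter≡sum P? (x ∷ xs) with P? x
  ... | yes _ = cong suc (length-filter≡sum P? xs)
  ... | no  _ = length-filter≡sum P? xs

  countPairs-permute : ∀ {P : Pred ℕ 0ℓ} (P? : Decidable P) → ¬ P 0 →
    ∀ H → IsWeightedGraph H → (π : Permutation d d) →
    length (filter (P? ∘ uncurry (λ a b → H (π ⟨$⟩ʳ a) (π ⟨$⟩ʳ b))) pairs)
      ≡ length (filter (P? ∘ uncurry H) pairs)
  countPairs-permute {P} P? ¬P0 H (H-sym , H-diag) π = begin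
    length (filter (P? ∘ uncurry Hπ) pairs)  ≡⟨ length-filter≡sum (P? ∘ uncurry Hπ) pairs ⟩
    sumPairs (λ a b → χ (Hπ a b))             ≡⟨ sumPairs-permute (λ a b → χ (H a b)) χH-weighted π ⟩
    sumPairs (λ a b → χ (H a b))              ≡⟨ length-filter≡sum (P? ∘ uncurry H) pairs ⟨
    length (filter (P? ∘ uncurry H) pairs)   ∎
    where
    open ≡-Reasoning
    Hπ = λ a b → H (π ⟨$⟩ʳ a) (π ⟨$⟩ʳ b)
    χ : ℕ → ℕ
    χ m = if does (P? m) then 1 else 0
    χ0≡0 : χ 0 ≡ 0
    χ0≡0 with P? 0
    ... | yes P0 = ⊥-elim (¬P0 P0)
    ... | no _   = refl
    χH-weighted : IsWeightedGraph (λ a b → χ (H a b))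
    χH-weighted = (λ i j → cong χ (H-sym i j)) , (λ i → trans (cong χ (H-diag i)) χ0≡0)

module FinPermutations where

  open import Data.Fin as Fin using (punchOut)
  import Data.Fin.Properties as FinP
  open import Data.Fin.Permutation using (Permutation; _⟨$⟩ʳ_)
  open import Data.Nat.Properties using (<-irrefl)
  open import Data.Product using (∃; _,_; proj₁; proj₂; Σ)
  open import Data.Empty using (⊥-elim)
  open import Function.Bundles using (mk↔ₛ′)
  open import Function.Definitions using (Injective)
  open import Relation.Nullary using (yes; no)
  open import Relation.Binary.PropositionalEquality using (refl; sym)

  injective⇒surjective : ∀ {n} (f : Fin n → Fin n) → Injective _≡_ _≡_ f → ∀ y → ∃ λ x → f x ≡ y
  injective⇒surjective {suc m} f f-inj y with FinP.any? (λ x → f x FinP.≟ y)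
  ... | yes hit = hit
  ... | no miss = ⊥-elim (<-irrefl refl (FinP.injective⇒≤ g-inj))
    where
    -- Missing y, f would inject Fin (suc m) into Fin m.
    y≢f : ∀ i → ¬ y ≡ f i
    y≢f i y≡fi = miss (i , sym y≡fi)
    g : Fin (suc m) → Fin m
    g i = punchOut (y≢f i)
    g-inj : Injective _≡_ _≡_ g
    g-inj {i} {j} gi≡gj = f-inj (FinP.punchOut-injective (y≢f i) (y≢f j) gi≡gj)

  injective⇒permutation : ∀ {n} (f : Fin n → Fin n) → Injective _≡_ _≡_ f →
    Σ (Permutation n n) λ π → ∀ i → π ⟨$⟩ʳ i ≡ f i
  injective⇒permutation f f-inj =
    mk↔ₛ′ f f⁻¹ (λ y → proj₂ (surj y)) (λ x → f-inj (proj₂ (surj (f x)))) , λ _ → refl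
    where
    surj = injective⇒surjective f f-inj
    f⁻¹ = λ y → proj₁ (surj y)

module Orbits {d : ℕ} where

  open import Data.Nat using (zero)
  open import Data.Fin.Permutation as Permutation using (_⟨$⟩ˡ_)
  import Data.Fin.Properties as FinP
  open import Data.Vec as Vec using (lookup)
  import Data.Vec.Properties as Vec
  open import Data.List.Relation.Unary.Any using (Any; here)
  import Data.List.Relation.Unary.Any.Properties as Any
  open import Data.List.Relation.Unary.AllPairs using (AllPairs)
  import Data.List.Relation.Unary.Unique.DecSetoid.Properties as Unique
  open import Data.List.Membership.Propositional using (_∈_; lose)
  import Data.List.Membership.Propositional.Properties as Mem
  open import Data.Product using (∃; _×_; _,_; proj₁; proj₂)
  open import Function.Definitions using (Injective)
  open import Level using (0ℓ)
  open import Relation.Binary.Bundles using (DecSetoid)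
  open import Relation.Nullary.Decidable using (_→-dec_)
  open import Relation.Binary.PropositionalEquality using (refl; cong₂; sym; trans)
  open Graphs {d}
  open FinPermutations

  infix 4 _≈ᴳ_
  _≈ᴳ_ : Graph d → Graph d → Set
  G ≈ᴳ H = ∀ a b → G a b ≡ H a b

  relabel : Graph d → (Fin d → Fin d) → Graph d
  relabel H f a b = H (f a) (f b)

  relabel-weighted : ∀ {H} f → IsWeightedGraph H → IsWeightedGraph (relabel H f)
  relabel-weighted f (H-sym , H-diag) = (λ a b → H-sym (f a) (f b)) , (λ a → H-diag (f a))

  relabel≈⇒≅ : ∀ {H K} f → Injective _≡_ _≡_ f → relabel H f ≈ᴳ K → H ≅ K
  relabel≈⇒≅ {H} f f-inj Hf≈K = Permutation.flip π , λ i j →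
    trans (sym (Hf≈K (π ⟨$⟩ˡ i) (π ⟨$⟩ˡ j)))
      (trans (cong₂ H (π≗f _) (π≗f _)) (cong₂ H (Permutation.inverseʳ π) (Permutation.inverseʳ π)))
    where
    π = proj₁ (injective⇒permutation f f-inj)
    π≗f = λ i → sym (proj₂ (injective⇒permutation f f-inj) i)

  graph-decSetoid : DecSetoid 0ℓ 0ℓ
  graph-decSetoid = record
    { Carrier = Graph d
    ; _≈_ = _≈ᴳ_
    ; isDecEquivalence = record
      { isEquivalence = record
        { refl  = λ a b → refl
        ; sym   = λ G≈H a b → sym (G≈H a b)
        ; trans = λ G≈H H≈K a b → trans (G≈H a b) (H≈K a b) }
      ; _≟_ = _≟G_ } }

  orbit-unique : ∀ H → AllPairs (λ G K → ¬ G ≈ᴳ K) (orbit H)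
  orbit-unique H = Unique.deduplicate-! graph-decSetoid _

  ∈-orbit⁻ : ∀ {H z} → z ∈ orbit H → ∃ λ f → Injective _≡_ _≡_ f × z ≡ relabel H f
  ∈-orbit⁻ {H} z∈
    with v , v∈ , refl ← Mem.∈-map⁻ (λ v → relabel H (lookup v)) (Any.deduplicate⁻ _≟G_ z∈) =
    lookup v , (λ {a} {b} → proj₂ (Mem.∈-filter⁻ injective? {xs = vecs d} v∈) a b) , refl
    where
    injective? = λ v → FinP.all? λ a → FinP.all? λ b → (lookup v a FinP.≟ lookup v b) →-dec (a FinP.≟ b)

  ∈-vecs : ∀ k (w : Vec.Vec (Fin d) k) → w ∈ vecs k
  ∈-vecs zero    Vec.[]       = here refl
  ∈-vecs (suc k) (i Vec.∷ w) =
    Mem.∈-concat⁺′ (Mem.∈-map⁺ (i Vec.∷_) (∈-vecs k w)) (Mem.∈-map⁺ _ (Mem.∈-allFin i))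

  orbit-∋-self : ∀ H → Any (_≈ᴳ H) (orbit H)
  orbit-∋-self H = Any.deduplicate⁺ _≟G_ (λ K≈G G≈H a b → trans (K≈G a b) (G≈H a b))
    (lose (Mem.∈-map⁺ (λ v → relabel H (lookup v)) id∈perms)
      (λ a b → cong₂ H (Vec.lookup-allFin a) (Vec.lookup-allFin b)))
    where
    id∈perms : Vec.allFin d ∈ perms
    id∈perms = Mem.∈-filter⁺ _ (∈-vecs d (Vec.allFin d))
      (λ a b eq → trans (sym (Vec.lookup-allFin a)) (trans eq (Vec.lookup-allFin b)))

module RootGraphs {c ℓ} (L : Field c ℓ) (V : FieldStuff.Valuation L) {d : ℕ}
  (x : Fin d → Field.Carrier L) (x-injective : ∀ i j → Field._≈_ L (x i) (x j) → i ≡ j) where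

  open import Data.Nat as ℕ using (zero; _+_; _*_; _∸_; _≤?_; _<?_; z≤n; s≤s)
  import Data.Nat.Properties as ℕP
  open import Data.Rational as ℚ using (0ℚ)
  import Data.Rational.Properties as ℚP
  open import Data.Fin using (_≟_)
  import Data.Fin.Properties as FinP
  open import Data.Bool using (if_then_else_)
  open import Data.List using (filter; length; foldr)
  import Data.List.Properties as List
  open import Data.List.Membership.Propositional using (_∈_; find)
  open import Data.List.Relation.Unary.All as All using (All)
  import Data.List.Relation.Unary.All.Properties as All
  open import Data.List.Relation.Binary.Sublist.Propositional using (⊆-refl)
  open import Data.List.Relation.Binary.Sublist.Heterogeneous.Properties using (length-mono-≤; ⊆-filter-Sublist)
  open import Data.Product using (_×_; _,_; proj₁; uncurry)
  open import Data.Sum using (_⊎_; inj₁; inj₂)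
  open import Data.Empty using (⊥-elim)
  open import Relation.Nullary using (yes; no; does)
  open import Relation.Nullary.Decidable using (dec-true; dec-false)
  open import Relation.Binary.PropositionalEquality using (refl; cong; sym; trans; subst; subst₂; module ≡-Reasoning)
  open import Relation.Binary.Definitions using (tri<; tri≈; tri>)
  import Algebra.Properties.Group as GroupProperties
  import Algebra.Properties.AbelianGroup as AbelianGroupProperties
  open import Algebra.Properties.Monoid.Mult ℚP.+-0-monoid using (×-homo-+)

  open Field L using (_-_)
  open FieldStuff L using (module Valuation)
  open Valuation V
  open ValuationProperties L V
  open Setup L V x
  open Graphs {d}
  open Orbits {d}
  open UnorderedPairs {d}
  open FinPermutations using (injective⇒permutation)

  -- The junk value 0 at ∞ only occurs on the diagonal, which never enters a sum over pairs.
  δℚ : Fin d × Fin d → ℚ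
  δℚ (i , j) with δ i j
  ... | fin q = q
  ... | ∞     = 0ℚ

  δ-finite : ∀ {i j} → ¬ i ≡ j → δ i j ≡ fin (δℚ (i , j))
  δ-finite {i} {j} i≢j with δ i j in δ≡
  ... | fin q = refl
  ... | ∞     = ⊥-elim (i≢j (x-injective i j
    (GroupProperties.x∙y⁻¹≈ε⇒x≈y (Field.+-group L) (x i) (x j) (ord-∞ _ δ≡))))

  δ-sym : ∀ i j → δ i j ≡ δ j i
  δ-sym i j = trans (sym (ord-neg (x i - x j)))
                    (ord-cong (AbelianGroupProperties.⁻¹-anti-homo‿- (Field.+-abelianGroup L) (x i) (x j)))

  rank-sym : ∀ i j → rank i j ≡ rank j i
  rank-sym i j = cong rankOf (δ-sym i j)

  rankOf-antitone : ∀ a b → rankOf a ℕ.< rankOf b → b <∞ a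
  rankOf-antitone a b rank-a<rank-b with b <∞? a
  ... | yes b<a = b<a
  ... | no  b≮a = ⊥-elim (ℕP.<⇒≱ rank-a<rank-b (s≤s (length-mono-≤
          (⊆-filter-Sublist (b <∞?_) (a <∞?_) (λ { refl → ≮∞-<∞-trans b≮a }) (⊆-refl {x = vals})))))

  open Rearrangement δℚ

  ord-term : ∀ H → ord (term H) ≡ fin (ℚ.- weight (λ p → 2 * uncurry H p) pairs)
  ord-term H = ord-⁻¹ (ord-product _ _ pairs (All.tabulate λ {p} p∈ →
    ord-pow (2 * uncurry H p) (δ-finite (FinP.<⇒≢ (∈-pairs⁻ p∈)))))

  term-cong : ∀ {H K} → H ≈ᴳ K → term H ≡ term K
  term-cong H≈K = cong (λ ws → Field._⁻¹ L (foldr (Field._*_ L) (Field.1# L) ws))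
    (List.map-cong (λ (i , j) → cong (λ w → FieldStuff.pow L (x i - x j) (2 * w)) (H≈K i j)) pairs)

  weight-double : ∀ (h : Fin d × Fin d → ℕ) →
    weight (λ p → 2 * h p) pairs ≡ weight h pairs ℚ.+ weight h pairs
  weight-double h = trans (cong sumℚ (List.map-cong (λ p → double (h p) (δℚ p)) pairs)) (sumℚ-map-+ _ _ pairs)
    where
    double : ∀ m q → (2 * m) ×ℚ q ≡ m ×ℚ q ℚ.+ m ×ℚ q
    double m q = trans (×-homo-+ q m (m + 0)) (cong (λ k → m ×ℚ q ℚ.+ k ×ℚ q) (ℕP.+-identityʳ m))

  weight-<⇒ord-term-> : ∀ H K → weight (uncurry H) pairs ℚ.< weight (uncurry K) pairs →
    ord (term K) <∞ ord (term H)
  weight-<⇒ord-term-> H K H<K = subst₂ _<∞_ (sym (ord-term K)) (sym (ord-term H))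
    (fin<fin (ℚP.neg-antimono-< (subst₂ ℚ._<_ (sym (weight-double (uncurry H))) (sym (weight-double (uncurry K)))
      (ℚP.+-mono-< H<K H<K))))

  private
    on-diagonal : ∀ (i : Fin d) t → (if does (i ≟ i) then 0 else t) ≡ 0
    on-diagonal i t = cong (λ b → if b then 0 else t) (dec-true (i ≟ i) refl)

    off-diagonal : ∀ {i j : Fin d} t → ¬ i ≡ j → (if does (i ≟ j) then 0 else t) ≡ t
    off-diagonal t i≢j = cong (λ b → if b then 0 else t) (dec-false (_ ≟ _) i≢j)

    inside : ∀ {r k} t → r ℕ.≤ k → (if does (r ≤? k) then t else 0) ≡ t
    inside t r≤k = cong (λ b → if b then t else 0) (dec-true (_ ≤? _) r≤k)

    outside : ∀ {r k} t → ¬ r ℕ.≤ k → (if does (r ≤? k) then t else 0) ≡ 0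
    outside t r≰k = cong (λ b → if b then t else 0) (dec-false (_ ≤? _) r≰k)

    on-and-off-diagonal : {P : Fin d → Fin d → Set} →
      (∀ i → P i i) → (∀ {i j} → ¬ i ≡ j → P i j) → ∀ i j → P i j
    on-and-off-diagonal on off i j with i ≟ j
    ... | yes refl = on i
    ... | no  i≢j  = off i≢j

  Gn-diag : ∀ k i → Gn k i i ≡ 0
  Gn-diag k i = on-diagonal i _

  Gn-inside : ∀ k {i j} → ¬ i ≡ j → rank i j ℕ.≤ k → Gn k i j ≡ suc k ∸ rank i j
  Gn-inside k i≢j r≤k = trans (off-diagonal _ i≢j) (inside _ r≤k)

  Gn-outside : ∀ k {i j} → ¬ i ≡ j → ¬ rank i j ℕ.≤ k → Gn k i j ≡ 0
  Gn-outside k i≢j r≰k = trans (off-diagonal _ i≢j) (outside _ r≰k)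

  G′n-inside : ∀ k {i j} → ¬ i ≡ j → rank i j ℕ.≤ k → G′n k i j ≡ suc (suc k) ∸ rank i j
  G′n-inside k i≢j r≤k = trans (off-diagonal _ i≢j) (inside _ r≤k)

  Gn-sym : ∀ k i j → Gn k i j ≡ Gn k j i
  Gn-sym k = on-and-off-diagonal (λ i → refl) λ {i} {j} i≢j →
    trans (off-diagonal _ i≢j) (trans (cong (λ r → if does (r ≤? k) then suc k ∸ r else 0) (rank-sym i j))
      (sym (off-diagonal _ (λ j≡i → i≢j (sym j≡i)))))

  Gn-weighted : ∀ k → IsWeightedGraph (Gn k)
  Gn-weighted k = Gn-sym k , Gn-diag k

  Gn-≤ : ∀ k i j → Gn k i j ℕ.≤ suc k
  Gn-≤ k = on-and-off-diagonal (λ i → subst (ℕ._≤ suc k) (sym (Gn-diag k i)) z≤n) off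
    where
    off : ∀ {i j} → ¬ i ≡ j → Gn k i j ℕ.≤ suc k
    off {i} {j} i≢j with rank i j ≤? k
    ... | yes r≤k = subst (ℕ._≤ suc k) (sym (Gn-inside k i≢j r≤k)) (ℕP.m∸n≤m (suc k) (rank i j))
    ... | no  r≰k = subst (ℕ._≤ suc k) (sym (Gn-outside k i≢j r≰k)) z≤n

  <-Gn⇒ : ∀ K t {i j} → ¬ i ≡ j → t ℕ.< Gn K i j → t + rank i j ℕ.≤ K
  <-Gn⇒ K t {i} {j} i≢j t<G with rank i j ≤? K
  ... | yes r≤K = ℕP.m≤o∸n⇒m+n≤o t r≤K
                    (ℕP.≤-pred (subst (t ℕ.<_) (trans (Gn-inside K i≢j r≤K) (ℕP.+-∸-assoc 1 r≤K)) t<G))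
  ... | no  r≰K with () ← subst (t ℕ.<_) (Gn-outside K i≢j r≰K) t<G

  <-Gn⇐ : ∀ K t {i j} → ¬ i ≡ j → t + rank i j ℕ.≤ K → t ℕ.< Gn K i j
  <-Gn⇐ K t {i} {j} i≢j t+r≤K = subst (t ℕ.<_) (sym (trans (Gn-inside K i≢j r≤K) (ℕP.+-∸-assoc 1 r≤K)))
    (s≤s (ℕP.m+n≤o⇒m≤o∸n t t+r≤K))
    where r≤K = ℕP.≤-trans (ℕP.m≤n+m (rank i j) t) t+r≤K

  -- The superlevel sets of G_K(f) are {rank ≤ K - t}, i.e. {ord(x_i - x_j) ≥ d_{K-t}(f)}.
  Gn-upper : ∀ K t {p q} → p ∈ pairs → q ∈ pairs →
    t ℕ.< uncurry (Gn K) p → ¬ t ℕ.< uncurry (Gn K) q → δℚ q ℚ.< δℚ p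
  Gn-upper K t {i , j} {k , l} p∈ q∈ t<Gp t≮Gq =
    fin-<∞ (subst₂ _<∞_ (δ-finite k≢l) (δ-finite i≢j) (rankOf-antitone (δ i j) (δ k l) rank-p<rank-q))
    where
    i≢j = FinP.<⇒≢ (∈-pairs⁻ p∈)
    k≢l = FinP.<⇒≢ (∈-pairs⁻ q∈)
    fin-<∞ : ∀ {a b} → fin a <∞ fin b → a ℚ.< b
    fin-<∞ (fin<fin a<b) = a<b
    rank-p<rank-q : rank i j ℕ.< rank k l
    rank-p<rank-q = ℕP.+-cancelˡ-< t _ _ (ℕP.≤-<-trans (<-Gn⇒ K t i≢j t<Gp)
                      (ℕP.≰⇒> (λ t+r≤K → t≮Gq (<-Gn⇐ K t k≢l t+r≤K))))

  ≈ᴳ-from-pairs : ∀ {H K} → IsWeightedGraph H → IsWeightedGraph K →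
    All (λ p → uncurry H p ≡ uncurry K p) pairs → H ≈ᴳ K
  ≈ᴳ-from-pairs {H} {K} (H-sym , H-diag) (K-sym , K-diag) H≡K i j with FinP.<-cmp i j
  ... | tri< i<j _ _  = All.lookup H≡K (∈-pairs⁺ i<j)
  ... | tri≈ _ refl _ = trans (H-diag i) (sym (K-diag i))
  ... | tri> _ _ j<i  = trans (H-sym i j) (trans (All.lookup H≡K (∈-pairs⁺ j<i)) (K-sym j i))

  count : ℕ → Graph d → ℕ
  count t H = length (filter (λ p → t <? uncurry H p) pairs)

  count-0≡numEdges : ∀ H → count 0 H ≡ numEdges H
  count-0≡numEdges H = cong length (List.filter-≐ _ _ (ℕP.n>0⇒n≢0 , ℕP.n≢0⇒n>0) pairs)

  count-suc-≡ : ∀ {H K} → (∀ i j → H i j ≡ K i j ⊎ (H i j ℕ.≤ 1 × K i j ℕ.≤ 1)) →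
    ∀ t → count (suc t) H ≡ count (suc t) K
  count-suc-≡ {H} {K} H~K t = cong length (List.filter-≐ _ _ (to H~K , to (λ i j → swap (H~K i j))) pairs)
    where
    swap : ∀ {i j} → H i j ≡ K i j ⊎ (H i j ℕ.≤ 1 × K i j ℕ.≤ 1) →
      K i j ≡ H i j ⊎ (K i j ℕ.≤ 1 × H i j ℕ.≤ 1)
    swap (inj₁ H≡K)         = inj₁ (sym H≡K)
    swap (inj₂ (H≤1 , K≤1)) = inj₂ (K≤1 , H≤1)
    to : ∀ {A B : Graph d} → (∀ i j → A i j ≡ B i j ⊎ (A i j ℕ.≤ 1 × B i j ℕ.≤ 1)) →
      ∀ {p} → suc t ℕ.< uncurry A p → suc t ℕ.< uncurry B p
    to A~B {i , j} t<A with A~B i j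
    ... | inj₁ A≡B       = subst (suc t ℕ.<_) A≡B t<A
    ... | inj₂ (A≤1 , _) = ⊥-elim (ℕP.<⇒≱ t<A (ℕP.≤-trans A≤1 (s≤s z≤n)))

  𝒢-suc⇒≈Gn-above-1 : ∀ n {G} → 𝒢-suc n G →
    ∀ i j → G i j ≡ Gn (suc n) i j ⊎ (G i j ℕ.≤ 1 × Gn (suc n) i j ℕ.≤ 1)
  𝒢-suc⇒≈Gn-above-1 n {G} (((_ , G-diag) , _) , _ , _ , G-old , G-new , _) =
    on-and-off-diagonal (λ i → inj₁ (trans (G-diag i) (sym (Gn-diag (suc n) i)))) off
    where
    off : ∀ {i j} → ¬ i ≡ j → G i j ≡ Gn (suc n) i j ⊎ (G i j ℕ.≤ 1 × Gn (suc n) i j ℕ.≤ 1)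
    off {i} {j} i≢j with rank i j ≤? n
    ... | yes r≤n = inj₁ (begin
      G i j                      ≡⟨ G-old i j old-edge ⟩
      G′n n i j                  ≡⟨ G′n-inside n i≢j r≤n ⟩
      suc (suc n) ∸ rank i j     ≡⟨ Gn-inside (suc n) i≢j (ℕP.m≤n⇒m≤1+n r≤n) ⟨
      Gn (suc n) i j             ∎)
      where
      open ≡-Reasoning
      old-edge : Edge (Gn n) i j
      old-edge Gn≡0 = ℕP.m>n⇒m∸n≢0 (s≤s r≤n) (trans (sym (Gn-inside n i≢j r≤n)) Gn≡0)
    ... | no r≰n = inj₂ (G≤1 , Gn-suc≤1)
      where
      G≤1 : G i j ℕ.≤ 1
      G≤1 with G i j ℕ.≟ 0
      ... | yes G≡0 = subst (ℕ._≤ 1) (sym G≡0) z≤n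
      ... | no  G≢0 = subst (ℕ._≤ 1) (sym (G-new i j G≢0 (λ old → old (Gn-outside n i≢j r≰n)))) ℕP.≤-refl
      Gn-suc≤1 : Gn (suc n) i j ℕ.≤ 1
      Gn-suc≤1 with rank i j ≤? suc n
      ... | yes r≤1+n = subst (ℕ._≤ 1) (sym (Gn-inside (suc n) i≢j r≤1+n))
            (ℕP.m≤n+o⇒m∸n≤o (suc (suc n)) (rank i j)
              (subst (suc (suc n) ℕ.≤_) (ℕP.+-comm 1 (rank i j)) (s≤s (ℕP.≰⇒> r≰n))))
      ... | no  r≰1+n = subst (ℕ._≤ 1) (sym (Gn-outside (suc n) i≢j r≰1+n)) z≤n

  module _ (n : ℕ) where

    private
      G⁺ = Gn (suc n)

    ordTermG⁺ : ℚ
    ordTermG⁺ = ℚ.- weight (λ p → 2 * uncurry G⁺ p) pairs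

    ord-term-G⁺-< : ∀ K → IsWeightedGraph K → (∀ i j → K i j ℕ.≤ suc (suc n)) →
      (∀ t → count t K ≡ count t G⁺) → ¬ K ≈ᴳ G⁺ → fin ordTermG⁺ <∞ ord (term K)
    ord-term-G⁺-< K K-weighted K≤ same-counts K≉G⁺ =
      subst (_<∞ ord (term K)) (ord-term G⁺) (weight-<⇒ord-term-> K G⁺
        (weight-<-rearrangement (uncurry K) (uncurry G⁺) (suc (suc n)) pairs
          (All.tabulate λ {(i , j)} _ → K≤ i j) (All.tabulate λ {(i , j)} _ → Gn-≤ (suc n) i j)
          same-counts (Gn-upper (suc n))
          (All.¬All⇒Any¬ (λ p → uncurry K p ℕ.≟ uncurry G⁺ p) pairs
            (λ K≡G⁺ → K≉G⁺ (≈ᴳ-from-pairs K-weighted (Gn-weighted (suc n)) K≡G⁺)))))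

    ord-term-orbit-< : ∀ H → IsWeightedGraph H → (∀ i j → H i j ℕ.≤ suc (suc n)) →
      (∀ t → count t H ≡ count t G⁺) →
      ∀ {z} → z ∈ orbit H → ¬ z ≈ᴳ G⁺ → fin ordTermG⁺ <∞ ord (term z)
    ord-term-orbit-< H H-weighted H≤ same-counts z∈ z≉G⁺ with f , f-inj , refl ← ∈-orbit⁻ {H} z∈ =
      ord-term-G⁺-< (relabel H f) (relabel-weighted f H-weighted) (λ a b → H≤ (f a) (f b))
        (λ t → trans (countPairs-permute (t <?_) (λ ()) H H-weighted π) (same-counts t))
        z≉G⁺
      where π = proj₁ (injective⇒permutation f f-inj)

    ord-J-G⁺ : ord (J G⁺) ≡ fin ordTermG⁺
    ord-J-G⁺ with y , y∈ , y≈G⁺ ← find (orbit-∋-self G⁺) =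
      ord-sum-uniqueMin _≈ᴳ_ (λ G≈H a b → sym (G≈H a b)) term (trans (cong ord (term-cong y≈G⁺)) (ord-term G⁺))
        (orbit G⁺) (orbit-unique G⁺) y∈
        (All.tabulate λ z∈ z≉y → ord-term-orbit-< G⁺ (Gn-weighted (suc n)) (Gn-≤ (suc n)) (λ t → refl) z∈
          (λ z≈G⁺ → z≉y (λ a b → trans (z≈G⁺ a b) (sym (y≈G⁺ a b)))))

    ord-J-𝒢-suc-> : ∀ G → 𝒢-suc n G → ¬ G ≅ G⁺ → numEdges G ≡ numEdges G⁺ →
      fin ordTermG⁺ <∞ ord (J G)
    ord-J-𝒢-suc-> G G∈𝒢 G≇G⁺ same-edges = <∞-ord-sum _ (All.map⁺ (All.tabulate λ z∈ →
      ord-term-orbit-< G G-weighted G≤ same-counts z∈ (orbit-≉ z∈)))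
      where
      G-weighted = proj₁ (proj₁ G∈𝒢)
      G≈G⁺ = 𝒢-suc⇒≈Gn-above-1 n G∈𝒢
      G≤ : ∀ i j → G i j ℕ.≤ suc (suc n)
      G≤ i j with G≈G⁺ i j
      ... | inj₁ G≡G⁺      = subst (ℕ._≤ suc (suc n)) (sym G≡G⁺) (Gn-≤ (suc n) i j)
      ... | inj₂ (G≤1 , _) = ℕP.≤-trans G≤1 (s≤s z≤n)
      same-counts : ∀ t → count t G ≡ count t G⁺
      same-counts zero    = trans (count-0≡numEdges G) (trans same-edges (sym (count-0≡numEdges G⁺)))
      same-counts (suc t) = count-suc-≡ G≈G⁺ t
      orbit-≉ : ∀ {z} → z ∈ orbit G → ¬ z ≈ᴳ G⁺
      orbit-≉ z∈ z≈G⁺ with f , f-inj , refl ← ∈-orbit⁻ {G} z∈ = G≇G⁺ (relabel≈⇒≅ f f-inj z≈G⁺)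

lemma3p6 : ∀ {c ℓ} (L : Field c ℓ) (inK : Field.Carrier L → Set c)
    → FieldStuff.IsSubfield L inK
    → FieldStuff.IsAlgClosed L
    → FieldStuff.IsAlgebraicOver L inK
    → (V : FieldStuff.Valuation L)
    → FieldStuff.IsDiscreteNormalisedOn L V inK
    → (d : ℕ) (f : Vec (Field.Carrier L) (suc d))
    → All inK (toList f)
    → ¬ (Field._≈_ L (last f) (Field.0# L))
    → (x : Fin d → Field.Carrier L)
    → (∀ i j → Field._≈_ L (x i) (x j) → i ≡ j)
    → (∀ i → Field._≈_ L (FieldStuff.eval L (toList f) (x i)) (Field.0# L))
    → (n : ℕ) → n < Setup.k_f L V x
    → (G : Graph d)
    → Setup.𝒢-suc L V x n G
    → ¬ (Graphs._≅_ G (Setup.Gn L V x (suc n)))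
    → Graphs.numEdges G ≡ Graphs.numEdges (Setup.Gn L V x (suc n))
    → FieldStuff.Valuation.ord {L = L} V (Setup.J L V x (Setup.Gn L V x (suc n)))
        <∞ FieldStuff.Valuation.ord {L = L} V (Setup.J L V x G)
lemma3p6 L _ _ _ _ V _ d _ _ _ x x-injective _ n _ G G∈𝒢 G≇Gn+1 same-edges =
  subst (_<∞ ord (J G)) (sym (ord-J-G⁺ n)) (ord-J-𝒢-suc-> n G G∈𝒢 G≇Gn+1 same-edges)
  where
  open RootGraphs L V x x-injective
  open Setup L V x using (J)
  open FieldStuff.Valuation V using (ord)
  open import Relation.Binary.PropositionalEquality using (subst; sym)
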